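{- Let $r,c,t$ be positive integers. If $T\in SSYT(r,c,t)$ is unmatched by $M$, then $\mathrm{rank}(T)=\|T\|-c\binom{r}{2}$ is even, where $\|T\|$ is the sum of the entries of $T$.
   Context: $SSYT(r,c,t)$ is the set of $r\times c$ arrays $T$ (rows $1,\dots,r$ top to bottom) with entries in $\{0,\dots,r+t-1\}$, weakly increasing along rows and strictly increasing down columns. For a row $R$ and value $i$, $(R,i)$ satisfies (1) if $i$ is odd, occurs in row $R$, and the number of occurrences of $i$ in row $R$ without $i-1$ immediately above (vacuous for row $1$) is odd; $(R,i)$ satisfies (2) if $i$ is even, $i<r+t-1$, $i$ occurs in row $R$, the rightmost occurrence of $i$ in row $R$ does not have $i+1$ immediately below it (vacuous for $R=r$), and the number of occurrences of $i+1$ in row $R$ without $i$ immediately above is even (possibly zero). $T$ is unmatched by $M$ if no $(R,i)$ satisfies (1) or (2). -}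

module Defs where

open import Data.Nat using (ℕ; zero; suc; _+_; _*_; _∸_; _<_; _≤_)
open import Data.Nat.Properties using (_≟_)
open import Data.Nat.Combinatorics using (_C_)
open import Data.Fin using (Fin; toℕ; inject₁) renaming (zero to fzero; suc to fsuc)
open import Data.List using (List; length; filter; map)
open import Data.Nat.ListAction using (sum)
open import Data.Product using (_×_; Σ; ∃; ∃-syntax; _,_)
open import Data.Sum using (_⊎_)
open import Data.Empty using (⊥)
open import Data.Unit using (⊤)
open import Relation.Nullary using (¬_; Dec; yes; no)
open import Relation.Nullary.Decidable using (¬?; _×-dec_)
open import Relation.Binary.PropositionalEquality using (_≡_)
open import Data.Integer using (ℤ; +_; _-_)
open import Data.Integer.Divisibility using (_∣_)
open import Data.Nat.DivMod using (_%_)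
import Data.List as List

Even : ℕ → Set
Even n = n % 2 ≡ 0

Odd : ℕ → Set
Odd n = n % 2 ≡ 1

-- A tableau of shape r × c with natural-number entries; rows and columns
-- are indexed from 0 (row 0 is the paper's row 1, the top row).
Tableau : ℕ → ℕ → Set
Tableau r c = Fin r → Fin c → ℕ

IsSSYT : (r c t : ℕ) → Tableau r c → Set
IsSSYT r c t T =
  (∀ R j → T R j < r + t) ×
  (∀ R (j j' : Fin c) → toℕ j ≤ toℕ j' → T R j ≤ T R j') ×
  (∀ (R R' : Fin r) j → toℕ R < toℕ R' → T R j < T R' j)

AboveIs : ∀ {r c} → Tableau (suc r) c → Fin (suc r) → Fin c → ℕ → Set
AboveIs T fzero j v = ⊥
AboveIs T (fsuc R) j v = T (inject₁ R) j ≡ v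

aboveIs? : ∀ {r c} (T : Tableau (suc r) c) R j v → Dec (AboveIs T R j v)
aboveIs? T fzero j v = no λ ()
aboveIs? T (fsuc R) j v = T (inject₁ R) j ≟ v

BelowIs : ∀ {r c} → Tableau r c → Fin r → Fin c → ℕ → Set
BelowIs {suc r} T R j v = Σ (Fin r) λ R' → (toℕ R' ≡ toℕ R) × (T (fsuc R') j ≡ v)
BelowIs {zero} T () j v

-- number of occurrences of value v in row R with no (v ∸ 1) immediately above
-- (used with v ≥ 1 only, where v ∸ 1 = v - 1).
countNoAbove : ∀ {r c} → Tableau (suc r) c → Fin (suc r) → ℕ → ℕ
countNoAbove {r} {c} T R v =
  length (filter (λ j → (T R j ≟ v) ×-dec ¬? (aboveIs? T R j (v ∸ 1))) (List.allFin c))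

Cond1 : ∀ {r c} → Tableau (suc r) c → Fin (suc r) → ℕ → Set
Cond1 T R i =
  Odd i × (∃[ j ] T R j ≡ i) × Odd (countNoAbove T R i)

RightmostOcc : ∀ {r c} → Tableau r c → Fin r → ℕ → Fin c → Set
RightmostOcc T R i j = (T R j ≡ i) × (∀ j' → toℕ j < toℕ j' → ¬ (T R j' ≡ i))

Cond2 : ∀ {r c} → ℕ → Tableau (suc r) c → Fin (suc r) → ℕ → Set
Cond2 {r} t T R i =
  Even i × (i < suc r + t ∸ 1) × (∃[ j ] T R j ≡ i) ×
  (∀ j → RightmostOcc T R i j → ¬ BelowIs T R j (suc i)) ×
  Even (countNoAbove T R (suc i))

Unmatched : ∀ {r c} → ℕ → Tableau (suc r) c → Set
Unmatched t T = ∀ R i → ¬ (Cond1 T R i ⊎ Cond2 t T R i)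

norm : ∀ {r c} → Tableau r c → ℕ
norm {r} {c} T = sum (List.map (λ R → sum (List.map (T R) (List.allFin c))) (List.allFin r))

rank : ∀ {r c} → Tableau r c → ℤ
rank {r} {c} T = + norm T - + (c * (r C 2))

-- Work modulo 2.  Call an odd entry v fresh when the cell above it does not
-- hold v − 1.  Condition (1) failing says that for each odd v the number of
-- fresh entries equal to v is even, so every row has an even number of fresh
-- odd entries.  Condition (2) failing forces every even entry to have its
-- successor directly below it.  Hence the odd entries of row R + 1 are its
-- fresh odd entries together with the successors of the even entries of row
-- R, and the number of odd entries in row R is congruent to c · R.  Summing
-- over the rows, ‖T‖ ≡ c · binom(r, 2) (mod 2).
module Submission where

open import Defs
open import Algebra.Bundles using (CommutativeSemiring)
open import Data.Empty using (⊥-elim)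
open import Data.Fin.Base using (Fin; toℕ; inject₁) renaming (zero to fzero; suc to fsuc)
open import Data.Fin.Induction using (<-weakInduction)
open import Data.Fin.Properties using (toℕ-injective; toℕ-inject₁; ≤̄⇒inject₁<)
open import Data.Integer.Base using (+_; _⊖_)
open import Data.Integer.Divisibility using (_∣_)
open import Data.Integer.Properties using (m-n≡m⊖n; ∣⊖∣-≤; [1+m]⊖[1+n]≡m⊖n)
open import Data.List.Base using (_∷_; length; filter; tabulate; allFin)
import Data.List.Base as List
open import Data.List.Properties using (map-tabulate)
open import Data.Nat.Base using (ℕ; zero; suc; _+_; _*_; _∸_; _<_; _≤_; z≤n; s≤s; parity)
open import Data.Nat.Combinatorics using (_C_; nC1≡n; nCk+nC[k+1]≡[n+1]C[k+1])
open import Data.Nat.Divisibility using (m%n≡0⇒n∣m)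
open import Data.Nat.ListAction using (sum)
open import Data.Nat.Properties
  using ( _≟_; _<?_; ≤-refl; ≤-reflexive; ≤-pred; ≤-antisym; <-≤-trans; ≮⇒≥; m<n⇒m<1+n
        ; <-cmp; <-irrefl)
open import Data.Parity.Base as ℙ using (Parity; 0ℙ; 1ℙ; _⁻¹)
import Data.Parity.Properties as ℙ
open import Data.Product.Base using (∃; _×_; _,_; proj₁; proj₂)
open import Data.Sum.Base using (inj₁; inj₂)
open import Function.Base using (id; _∘_)
open import Relation.Binary.Definitions using (tri<; tri≈; tri>)
open import Relation.Binary.PropositionalEquality
  using (_≡_; refl; sym; trans; cong; cong₂; subst; module ≡-Reasoning)
open import Relation.Nullary using (¬_; Dec; yes; no)
open import Relation.Nullary.Decidable using (¬?; _×-dec_)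
open import Relation.Unary using (Pred; Decidable)

open import Algebra.Properties.CommutativeMonoid.Sum ℙ.+-0-commutativeMonoid
  using (sum-syntax; sum-cong-≗; sum-replicate-zero; ∑-distrib-+)
open import Algebra.Properties.Semiring.Sum (CommutativeSemiring.semiring ℙ.+-*-commutativeSemiring)
  using (*-distribˡ-sum)

open ≡-Reasoning

parity-suc : ∀ n → parity (suc n) ≡ parity n ⁻¹
parity-suc n = ℙ.+-homo-+ 1 n

parity-suc-injective : ∀ m n → parity (suc m) ≡ parity (suc n) → parity m ≡ parity n
parity-suc-injective m n eq = begin
  parity m          ≡⟨ sym (ℙ.suc-homo-⁻¹ m) ⟩
  parity (suc m) ⁻¹ ≡⟨ cong _⁻¹ eq ⟩
  parity (suc n) ⁻¹ ≡⟨ ℙ.suc-homo-⁻¹ n ⟩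
  parity n          ∎

parity-pred : ∀ n → parity n ≡ 1ℙ → parity (n ∸ 1) ≡ 0ℙ
parity-pred zero    ()
parity-pred (suc n) eq = trans (sym (ℙ.suc-homo-⁻¹ n)) (cong _⁻¹ eq)

parity≡0ℙ⇒Even : ∀ n → parity n ≡ 0ℙ → Even n
parity≡0ℙ⇒Even zero          _  = refl
parity≡0ℙ⇒Even (suc zero)    ()
parity≡0ℙ⇒Even (suc (suc n)) eq = parity≡0ℙ⇒Even n eq

parity≡1ℙ⇒Odd : ∀ n → parity n ≡ 1ℙ → Odd n
parity≡1ℙ⇒Odd zero          ()
parity≡1ℙ⇒Odd (suc zero)    _  = refl
parity≡1ℙ⇒Odd (suc (suc n)) eq = parity≡1ℙ⇒Odd n eq

parity≡1ℙ⇒0< : ∀ {n} → parity n ≡ 1ℙ → 0 < n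
parity≡1ℙ⇒0< {zero}  ()
parity≡1ℙ⇒0< {suc n} _ = s≤s z≤n

parity≡⇒2∣⊖ : ∀ m n → parity m ≡ parity n → + 2 ∣ m ⊖ n
parity≡⇒2∣⊖ zero n eq =
  subst (λ k → + 2 ∣ + k) (sym (∣⊖∣-≤ z≤n)) (m%n≡0⇒n∣m n 2 (parity≡0ℙ⇒Even n (sym eq)))
parity≡⇒2∣⊖ (suc m) zero eq = m%n≡0⇒n∣m (suc m) 2 (parity≡0ℙ⇒Even (suc m) eq)
parity≡⇒2∣⊖ (suc m) (suc n) eq =
  subst (+ 2 ∣_) (sym ([1+m]⊖[1+n]≡m⊖n m n)) (parity≡⇒2∣⊖ m n (parity-suc-injective m n eq))

𝟙 : ∀ {p} {P : Set p} → Dec P → Parity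
𝟙 (yes _) = 1ℙ
𝟙 (no _)  = 0ℙ

𝟙-yes : ∀ {p} {P : Set p} (P? : Dec P) → P → 𝟙 P? ≡ 1ℙ
𝟙-yes (yes _) _  = refl
𝟙-yes (no ¬p) p = ⊥-elim (¬p p)

𝟙-no : ∀ {p} {P : Set p} (P? : Dec P) → ¬ P → 𝟙 P? ≡ 0ℙ
𝟙-no (yes p) ¬p = ⊥-elim (¬p p)
𝟙-no (no _)  _  = refl

𝟙-×-dec : ∀ {p q} {P : Set p} {Q : Set q} (P? : Dec P) (Q? : Dec Q) →
          𝟙 (P? ×-dec Q?) ≡ 𝟙 P? ℙ.* 𝟙 Q?
𝟙-×-dec (yes _) (yes _) = refl
𝟙-×-dec (yes _) (no _)  = refl
𝟙-×-dec (no _)  _       = refl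

𝟙-<?-suc : ∀ m n → 𝟙 (m <? suc n) ≡ 𝟙 (m <? n) ℙ.+ 𝟙 (m ≟ n)
𝟙-<?-suc m n with <-cmp m n
... | tri< m<n m≢n _ = begin
  𝟙 (m <? suc n)              ≡⟨ 𝟙-yes (m <? suc n) (m<n⇒m<1+n m<n) ⟩
  1ℙ                          ≡⟨ sym (cong₂ ℙ._+_ (𝟙-yes (m <? n) m<n) (𝟙-no (m ≟ n) m≢n)) ⟩
  𝟙 (m <? n) ℙ.+ 𝟙 (m ≟ n)   ∎
... | tri≈ m≮n m≡n _ = begin
  𝟙 (m <? suc n)              ≡⟨ 𝟙-yes (m <? suc n) (s≤s (≤-reflexive m≡n)) ⟩
  1ℙ                          ≡⟨ sym (cong₂ ℙ._+_ (𝟙-no (m <? n) m≮n) (𝟙-yes (m ≟ n) m≡n)) ⟩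
  𝟙 (m <? n) ℙ.+ 𝟙 (m ≟ n)   ∎
... | tri> m≮n m≢n n<m = begin
  𝟙 (m <? suc n)              ≡⟨ 𝟙-no (m <? suc n) (λ m<1+n → <-irrefl refl (<-≤-trans n<m (≤-pred m<1+n))) ⟩
  0ℙ                          ≡⟨ sym (cong₂ ℙ._+_ (𝟙-no (m <? n) m≮n) (𝟙-no (m ≟ n) m≢n)) ⟩
  𝟙 (m <? n) ℙ.+ 𝟙 (m ≟ n)   ∎

𝟙-≟-*-parity : ∀ {p} {P : ℕ → Set p} m n (P? : ∀ v → Dec (P v)) →
               𝟙 (m ≟ n) ℙ.* (parity m ℙ.* 𝟙 (¬? (P? m))) ≡
               parity n ℙ.* 𝟙 ((m ≟ n) ×-dec ¬? (P? n))
𝟙-≟-*-parity m n P? with m ≟ n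
... | yes refl = sym (cong (parity m ℙ.*_) (𝟙-×-dec (yes refl) (¬? (P? m))))
... | no _     = sym (ℙ.*-zeroʳ (parity n))

∑-1ℙ : ∀ n → ∑[ i < n ] 1ℙ ≡ parity n
∑-1ℙ zero    = refl
∑-1ℙ (suc n) = trans (cong (1ℙ ℙ.+_) (∑-1ℙ n)) (sym (parity-suc n))

∑-⁻¹ : ∀ {n} (f : Fin n → Parity) → ∑[ i < n ] (f i ⁻¹) ≡ parity n ℙ.+ ∑[ i < n ] f i
∑-⁻¹ {n} f = trans (∑-distrib-+ (λ _ → 1ℙ) f) (cong (ℙ._+ ∑[ i < n ] f i) (∑-1ℙ n))

∑-parity-toℕ : ∀ n → ∑[ i < n ] parity (toℕ i) ≡ parity (n C 2)
∑-parity-toℕ zero    = refl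
∑-parity-toℕ (suc n) = begin
  ∑[ i < n ] parity (suc (toℕ i))     ≡⟨ sum-cong-≗ {n} (λ i → parity-suc (toℕ i)) ⟩
  ∑[ i < n ] (parity (toℕ i) ⁻¹)      ≡⟨ ∑-⁻¹ {n} (parity ∘ toℕ) ⟩
  parity n ℙ.+ ∑[ i < n ] parity (toℕ i) ≡⟨ cong₂ ℙ._+_ (cong parity (sym (nC1≡n n))) (∑-parity-toℕ n) ⟩
  parity (n C 1) ℙ.+ parity (n C 2)   ≡⟨ sym (ℙ.+-homo-+ (n C 1) (n C 2)) ⟩
  parity (n C 1 + n C 2)              ≡⟨ cong parity (nCk+nC[k+1]≡[n+1]C[k+1] n 1) ⟩
  parity (suc n C 2)                  ∎

parity-sum-tabulate : ∀ {n} (f : Fin n → ℕ) → parity (sum (tabulate f)) ≡ ∑[ i < n ] parity (f i)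
parity-sum-tabulate {zero}  f = refl
parity-sum-tabulate {suc n} f =
  trans (ℙ.+-homo-+ (f fzero) _) (cong (parity (f fzero) ℙ.+_) (parity-sum-tabulate (f ∘ fsuc)))

parity-sum-allFin : ∀ {n} (f : Fin n → ℕ) → parity (sum (List.map f (allFin n))) ≡ ∑[ i < n ] parity (f i)
parity-sum-allFin {n} f = trans (cong (parity ∘ sum) (map-tabulate id f)) (parity-sum-tabulate f)

module _ {a p} {A : Set a} {P : Pred A p} (P? : Decidable P) where

  filter-witness : ∀ xs → 0 < length (filter P? xs) → ∃ P
  filter-witness (x ∷ xs) nonempty with P? x
  ... | yes px = x , px
  ... | no _   = filter-witness xs nonempty

  parity-length-filter : ∀ {n} (g : Fin n → A) →
    parity (length (filter P? (tabulate g))) ≡ ∑[ i < n ] 𝟙 (P? (g i))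
  parity-length-filter {zero}  g = refl
  parity-length-filter {suc n} g with P? (g fzero)
  ... | yes _ = trans (parity-suc (length (filter P? (tabulate (g ∘ fsuc)))))
                       (cong _⁻¹ (parity-length-filter (g ∘ fsuc)))
  ... | no _  = parity-length-filter (g ∘ fsuc)

-- b is the entry directly below a; the first summand is 1ℙ exactly when b is
-- a fresh odd entry.
parity-below : ∀ a b → (parity a ≡ 0ℙ → b ≡ suc a) →
               parity b ≡ (parity b ℙ.* 𝟙 (¬? (a ≟ b ∸ 1))) ℙ.+ parity a ⁻¹
parity-below a b successor with parity a in a-parity
... | 0ℙ with refl ← successor refl = begin
  parity (suc a)                               ≡⟨ parity-suc a ⟩
  parity a ⁻¹                                  ≡⟨ cong _⁻¹ a-parity ⟩
  1ℙ                                           ≡⟨ cong (ℙ._+ 1ℙ) (sym (ℙ.*-zeroʳ (parity (suc a)))) ⟩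
  (parity (suc a) ℙ.* 0ℙ) ℙ.+ 1ℙ               ≡⟨ cong (λ x → (parity (suc a) ℙ.* x) ℙ.+ 1ℙ) fresh-0ℙ ⟩
  (parity (suc a) ℙ.* 𝟙 (¬? (a ≟ a))) ℙ.+ 1ℙ  ∎
  where
  fresh-0ℙ : 0ℙ ≡ 𝟙 (¬? (a ≟ a))
  fresh-0ℙ = sym (𝟙-no (¬? (a ≟ a)) (λ a≢a → a≢a refl))
... | 1ℙ with parity b in b-parity
...   | 0ℙ = refl
...   | 1ℙ = cong (ℙ._+ 0ℙ) (sym (𝟙-yes (¬? (a ≟ b ∸ 1)) a≢b∸1))
  where
  a≢b∸1 : ¬ a ≡ b ∸ 1
  a≢b∸1 a≡b∸1
    with () ← trans (sym a-parity) (trans (cong parity a≡b∸1) (parity-pred b b-parity))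

module UnmatchedSSYT {r c t : ℕ} {T : Tableau (suc r) c}
                     (ssyt : IsSSYT (suc r) c t T) (unmatched : Unmatched t T) where

  private
    bounded : ∀ R j → T R j < suc r + t
    bounded = proj₁ ssyt

    rows-weak : ∀ R (j j′ : Fin c) → toℕ j ≤ toℕ j′ → T R j ≤ T R j′
    rows-weak = proj₁ (proj₂ ssyt)

    columns-strict : ∀ (R R′ : Fin (suc r)) j → toℕ R < toℕ R′ → T R j < T R′ j
    columns-strict = proj₂ (proj₂ ssyt)

    column-step : ∀ (R : Fin r) j → T (inject₁ R) j < T (fsuc R) j
    column-step R j = columns-strict (inject₁ R) (fsuc R) j (≤̄⇒inject₁< ≤-refl)

  countNoAbove-even : ∀ R v → parity v ≡ 1ℙ → parity (countNoAbove T R v) ≡ 0ℙ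
  countNoAbove-even R v v-odd with parity (countNoAbove T R v) in count-parity
  ... | 0ℙ = refl
  ... | 1ℙ with (j , Tj≡v , _) ← filter-witness _ (allFin c) (parity≡1ℙ⇒0< count-parity) =
    ⊥-elim (unmatched R v (inj₁ ( parity≡1ℙ⇒Odd v v-odd
                                , (j , Tj≡v)
                                , parity≡1ℙ⇒Odd (countNoAbove T R v) count-parity)))

  successor-below-rightmost⇒successor-below :
    ∀ (R : Fin r) {j j′ v} → T (inject₁ R) j ≡ v → RightmostOcc T (inject₁ R) v j′ →
    T (fsuc R) j′ ≡ suc v → T (fsuc R) j ≡ suc v
  successor-below-rightmost⇒successor-below R {j} {j′} refl (_ , rightmost) below′
    with toℕ j′ <? toℕ j
  ... | yes j′<j = ⊥-elim (rightmost j j′<j refl)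
  ... | no j′≮j = ≤-antisym (subst (T (fsuc R) j ≤_) below′ (rows-weak (fsuc R) j j′ (≮⇒≥ j′≮j)))
                            (column-step R j)

  even-entry-has-successor-below : ∀ (R : Fin r) j → parity (T (inject₁ R) j) ≡ 0ℙ →
                                   T (fsuc R) j ≡ suc (T (inject₁ R) j)
  even-entry-has-successor-below R j v-even with T (fsuc R) j ≟ suc (T (inject₁ R) j)
  ... | yes below = below
  ... | no ¬below = ⊥-elim (unmatched (inject₁ R) v
          (inj₂ ( parity≡0ℙ⇒Even v v-even
                , <-≤-trans (column-step R j) (≤-pred (bounded (fsuc R) j))
                , (j , refl)
                , no-successor-below-rightmost
                , parity≡0ℙ⇒Even (countNoAbove T (inject₁ R) (suc v))
                                 (countNoAbove-even (inject₁ R) (suc v) suc-v-odd))))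
    where
    v = T (inject₁ R) j

    suc-v-odd : parity (suc v) ≡ 1ℙ
    suc-v-odd = trans (parity-suc v) (cong _⁻¹ v-even)

    no-successor-below-rightmost : ∀ j′ → RightmostOcc T (inject₁ R) v j′ →
                                   ¬ BelowIs T (inject₁ R) j′ (suc v)
    no-successor-below-rightmost j′ rightmost (R′ , R′≡R , below′) =
      ¬below (successor-below-rightmost⇒successor-below R refl rightmost
               (subst (λ R″ → T (fsuc R″) j′ ≡ suc v)
                      (toℕ-injective (trans R′≡R (toℕ-inject₁ R))) below′))

  freshOdd : Fin (suc r) → Fin c → Parity
  freshOdd R j = parity (T R j) ℙ.* 𝟙 (¬? (aboveIs? T R j (T R j ∸ 1)))

  private
    noAbove? : ∀ R v j → Dec ((T R j ≡ v) × ¬ AboveIs T R j (v ∸ 1))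
    noAbove? R v j = (T R j ≟ v) ×-dec ¬? (aboveIs? T R j (v ∸ 1))

    freshOdd-equal-to : ∀ R N j → 𝟙 (T R j ≟ N) ℙ.* freshOdd R j ≡ parity N ℙ.* 𝟙 (noAbove? R N j)
    freshOdd-equal-to R N j = 𝟙-≟-*-parity (T R j) N (λ v → aboveIs? T R j (v ∸ 1))

    freshOdd-below : Fin (suc r) → ℕ → Parity
    freshOdd-below R N = ∑[ j < c ] (𝟙 (T R j <? N) ℙ.* freshOdd R j)

    freshOdd-below-zero : ∀ R N → freshOdd-below R N ≡ 0ℙ
    freshOdd-below-zero R zero =
      trans (sum-cong-≗ {c} (λ j → cong (ℙ._* freshOdd R j) (𝟙-no (T R j <? 0) λ ()))) (sum-replicate-zero c)
    freshOdd-below-zero R (suc N) = begin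
      ∑[ j < c ] (𝟙 (T R j <? suc N) ℙ.* freshOdd R j)
        ≡⟨ sum-cong-≗ {c} (λ j → trans (cong (ℙ._* freshOdd R j) (𝟙-<?-suc (T R j) N))
                                       (ℙ.*-distribʳ-+ (freshOdd R j) (𝟙 (T R j <? N)) (𝟙 (T R j ≟ N)))) ⟩
      ∑[ j < c ] ((𝟙 (T R j <? N) ℙ.* freshOdd R j) ℙ.+ (𝟙 (T R j ≟ N) ℙ.* freshOdd R j))
        ≡⟨ ∑-distrib-+ (λ j → 𝟙 (T R j <? N) ℙ.* freshOdd R j)
                       (λ j → 𝟙 (T R j ≟ N) ℙ.* freshOdd R j) ⟩
      freshOdd-below R N ℙ.+ ∑[ j < c ] (𝟙 (T R j ≟ N) ℙ.* freshOdd R j)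
        ≡⟨ cong₂ ℙ._+_ (freshOdd-below-zero R N) (sum-cong-≗ {c} (freshOdd-equal-to R N)) ⟩
      ∑[ j < c ] (parity N ℙ.* 𝟙 (noAbove? R N j))
        ≡⟨ sym (*-distribˡ-sum (parity N) (𝟙 ∘ noAbove? R N)) ⟩
      parity N ℙ.* ∑[ j < c ] 𝟙 (noAbove? R N j)
        ≡⟨ cong (parity N ℙ.*_) (sym (parity-length-filter (noAbove? R N) id)) ⟩
      parity N ℙ.* parity (countNoAbove T R N)
        ≡⟨ odd-value-even-count ⟩
      0ℙ ∎
      where
      odd-value-even-count : parity N ℙ.* parity (countNoAbove T R N) ≡ 0ℙ
      odd-value-even-count with parity N in N-parity
      ... | 0ℙ = refl
      ... | 1ℙ = countNoAbove-even R N N-parity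

  ∑-freshOdd : ∀ R → ∑[ j < c ] freshOdd R j ≡ 0ℙ
  ∑-freshOdd R =
    trans (sum-cong-≗ {c} (λ j → cong (ℙ._* freshOdd R j) (sym (𝟙-yes (T R j <? suc r + t) (bounded R j)))))
          (freshOdd-below-zero R (suc r + t))

  rowParity : Fin (suc r) → Parity
  rowParity R = ∑[ j < c ] parity (T R j)

  rowParity-top : rowParity fzero ≡ 0ℙ
  rowParity-top = trans (sum-cong-≗ {c} (λ j → sym (ℙ.*-identityʳ (parity (T fzero j))))) (∑-freshOdd fzero)

  rowParity-suc : ∀ (R : Fin r) → rowParity (fsuc R) ≡ parity c ℙ.+ rowParity (inject₁ R)
  rowParity-suc R = begin
    ∑[ j < c ] parity (T (fsuc R) j)
      ≡⟨ sum-cong-≗ {c} (λ j → parity-below (T (inject₁ R) j) (T (fsuc R) j)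
                                             (even-entry-has-successor-below R j)) ⟩
    ∑[ j < c ] (freshOdd (fsuc R) j ℙ.+ parity (T (inject₁ R) j) ⁻¹)
      ≡⟨ ∑-distrib-+ (freshOdd (fsuc R)) (λ j → parity (T (inject₁ R) j) ⁻¹) ⟩
    ∑[ j < c ] freshOdd (fsuc R) j ℙ.+ ∑[ j < c ] (parity (T (inject₁ R) j) ⁻¹)
      ≡⟨ cong₂ ℙ._+_ (∑-freshOdd (fsuc R)) (∑-⁻¹ (λ j → parity (T (inject₁ R) j))) ⟩
    parity c ℙ.+ rowParity (inject₁ R) ∎

  rowParity≡c*R : ∀ R → rowParity R ≡ parity c ℙ.* parity (toℕ R)
  rowParity≡c*R = <-weakInduction (λ R → rowParity R ≡ parity c ℙ.* parity (toℕ R)) top step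
    where
    top : rowParity fzero ≡ parity c ℙ.* 0ℙ
    top = trans rowParity-top (sym (ℙ.*-zeroʳ (parity c)))

    step : ∀ R → rowParity (inject₁ R) ≡ parity c ℙ.* parity (toℕ (inject₁ R)) →
           rowParity (fsuc R) ≡ parity c ℙ.* parity (suc (toℕ R))
    step R ih = begin
      rowParity (fsuc R)                                  ≡⟨ rowParity-suc R ⟩
      parity c ℙ.+ rowParity (inject₁ R)
        ≡⟨ cong (parity c ℙ.+_) (trans ih (cong (λ i → parity c ℙ.* parity i) (toℕ-inject₁ R))) ⟩
      parity c ℙ.+ (parity c ℙ.* parity (toℕ R))
        ≡⟨ cong (ℙ._+ (parity c ℙ.* parity (toℕ R))) (sym (ℙ.*-identityʳ (parity c))) ⟩
      (parity c ℙ.* 1ℙ) ℙ.+ (parity c ℙ.* parity (toℕ R))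
        ≡⟨ sym (ℙ.*-distribˡ-+ (parity c) 1ℙ (parity (toℕ R))) ⟩
      parity c ℙ.* parity (toℕ R) ⁻¹
        ≡⟨ cong (parity c ℙ.*_) (sym (parity-suc (toℕ R))) ⟩
      parity c ℙ.* parity (suc (toℕ R)) ∎

  parity-norm : parity (norm T) ≡ parity (c * (suc r C 2))
  parity-norm = begin
    parity (norm T)
      ≡⟨ parity-sum-allFin (λ R → sum (List.map (T R) (allFin c))) ⟩
    ∑[ R < suc r ] parity (sum (List.map (T R) (allFin c)))
      ≡⟨ sum-cong-≗ {suc r} (λ R → trans (parity-sum-allFin (T R)) (rowParity≡c*R R)) ⟩
    ∑[ R < suc r ] (parity c ℙ.* parity (toℕ R))
      ≡⟨ sym (*-distribˡ-sum {suc r} (parity c) (parity ∘ toℕ)) ⟩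
    parity c ℙ.* ∑[ R < suc r ] parity (toℕ R)
      ≡⟨ cong (parity c ℙ.*_) (∑-parity-toℕ (suc r)) ⟩
    parity c ℙ.* parity (suc r C 2)
      ≡⟨ sym (ℙ.*-homo-* c (suc r C 2)) ⟩
    parity (c * (suc r C 2)) ∎

corollary5p6 : (r c t : ℕ) (T : Tableau (suc r) (suc c)) →
    IsSSYT (suc r) (suc c) (suc t) T → Unmatched (suc t) T →
    (+ 2) ∣ rank T
corollary5p6 r c t T ssyt unmatched =
  subst (+ 2 ∣_) (sym (m-n≡m⊖n (norm T) (suc c * (suc r C 2))))
        (parity≡⇒2∣⊖ (norm T) (suc c * (suc r C 2)) (UnmatchedSSYT.parity-norm ssyt unmatched))
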